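{- For $n\geq 1$, $$f_n(312,213,123)=\sum_{k=1}^n \mathcal{B}(k)\,c(n,k).$$
   Context: A forest on $[n]$ is an unordered rooted forest whose $n$ vertices are labeled bijectively by $[n]$. A forest avoids a pattern $\sigma$ if for every vertex $v$, the sequence of labels along the path from the root of the tree containing $v$ down to $v$ contains no subsequence in the same relative order as $\sigma$. $f_n(\sigma_1,\ldots,\sigma_m)$ is the number of forests on $[n]$ avoiding every $\sigma_i$. $\mathcal{B}(k)$ is the $k$th Bell number and $c(n,k)$ the unsigned Stirling number of the first kind (number of permutations of $[n]$ with exactly $k$ cycles). -}

module Defs where

open import Data.Nat using (ℕ; zero; suc; _+_; _*_; _<ᵇ_; _≡ᵇ_)
open import Data.Bool using (Bool; true; false; _∧_; not)
open import Data.Maybe using (Maybe; nothing; just)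
open import Data.Fin using (Fin; toℕ)
open import Data.Vec using (Vec; []; _∷_; lookup)
open import Data.List using (List; []; _∷_; map; _++_; length; zip; filterᵇ; concatMap; reverse; applyUpTo)
open import Data.Bool.ListAction using (all; any)
open import Data.Nat.ListAction using (sum)
open import Data.List using () renaming ([] to []ᴸ; _∷_ to _∷ᴸ_)
open import Data.Fin.Base using () renaming (zero to fzero; suc to fsuc)
open import Data.List.Base using (allFin)
open import Data.Product using (_×_; _,_)

-- Vertex i : Fin n carries the label (toℕ i + 1) ∈ [n] = {1,…,n}.
-- A forest is encoded by its parent map: for each vertex, either
-- nothing (it is a root) or just its parent.  Unordered rooted labelled
-- forests on [n] correspond bijectively to acyclic parent maps.

ParentMap : ℕ → Set
ParentMap n = Vec (Maybe (Fin n)) n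

allVecs : {A : Set} → List A → (k : ℕ) → List (Vec A k)
allVecs xs zero    = [] ∷ᴸ []ᴸ
allVecs xs (suc k) = concatMap (λ x → map (x ∷_) (allVecs xs k)) xs

allMaybeFin : (n : ℕ) → List (Maybe (Fin n))
allMaybeFin n = nothing ∷ᴸ map just (allFin n)

allParentMaps : (n : ℕ) → List (ParentMap n)
allParentMaps n = allVecs (allMaybeFin n) n

reachesRoot : {n : ℕ} → ParentMap n → ℕ → Fin n → Bool
reachesRoot p zero       v = false
reachesRoot p (suc fuel) v with lookup p v
... | nothing = true
... | just u  = reachesRoot p fuel u

-- the parent map is acyclic, i.e. it describes a rooted forest
-- (every root path has at most n vertices, so fuel n suffices)
isForest : {n : ℕ} → ParentMap n → Bool
isForest {n} p = all (reachesRoot p n) (allFin n)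

chainUp : {n : ℕ} → ParentMap n → ℕ → Fin n → List (Fin n)
chainUp p zero       v = v ∷ᴸ []ᴸ
chainUp p (suc fuel) v with lookup p v
... | nothing = v ∷ᴸ []ᴸ
... | just u  = v ∷ᴸ chainUp p fuel u

label : {n : ℕ} → Fin n → ℕ
label i = suc (toℕ i)

rootPathLabels : {n : ℕ} → ParentMap n → Fin n → List ℕ
rootPathLabels {n} p v = reverse (map label (chainUp p n v))

subseqs : {A : Set} → List A → List (List A)
subseqs []ᴸ        = []ᴸ ∷ᴸ []ᴸ
subseqs (x ∷ᴸ xs)  = map (x ∷ᴸ_) (subseqs xs) ++ subseqs xs

_==ᴮ_ : Bool → Bool → Bool
true  ==ᴮ b = b
false ==ᴮ b = not b

sameRelOrder : List ℕ → List ℕ → Bool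
sameRelOrder σ s =
  (length σ ≡ᵇ length s) ∧
  all (λ { (a , b) → all (λ { (c , d) → (a <ᵇ c) ==ᴮ (b <ᵇ d) }) (zip σ s) }) (zip σ s)

containsPattern : List ℕ → List ℕ → Bool
containsPattern σ w = any (sameRelOrder σ) (subseqs w)

avoids : {n : ℕ} → ParentMap n → List ℕ → Bool
avoids {n} p σ = all (λ v → not (containsPattern σ (rootPathLabels p v))) (allFin n)

avoidsAll : {n : ℕ} → ParentMap n → List (List ℕ) → Bool
avoidsAll p σs = all (avoids p) σs

f : ℕ → List (List ℕ) → ℕ
f n σs = length (filterᵇ (λ p → isForest p ∧ avoidsAll p σs) (allParentMaps n))

stirling1 : ℕ → ℕ → ℕ
stirling1 zero    zero    = 1
stirling1 zero    (suc k) = 0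
stirling1 (suc n) zero    = 0
stirling1 (suc n) (suc k) = n * stirling1 n (suc k) + stirling1 n k

stirling2 : ℕ → ℕ → ℕ
stirling2 zero    zero    = 1
stirling2 zero    (suc k) = 0
stirling2 (suc n) zero    = 0
stirling2 (suc n) (suc k) = suc k * stirling2 n (suc k) + stirling2 n k

bell : ℕ → ℕ
bell n = sum (applyUpTo (stirling2 n) (suc n))

bellStirlingSum : ℕ → ℕ
bellStirlingSum n = sum (applyUpTo (λ j → bell (suc j) * stirling1 n (suc j)) n)

module Submission where

-- A forest avoids 312, 213 and 123 iff every root path is its root followed by a decreasing
-- sequence, i.e. iff every vertex whose parent is not a root has a parent with a larger label.
-- Once the set of roots is fixed, this constrains the parents of the vertices independently;
-- deciding whether the smallest vertex is a root then gives W(0, r) = 1 and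
-- W(n+1, r) = W(n, r+1) + (r+n) W(n, r) for the number W(n, r) of such forests in which r
-- further roots are available as parents. By the recurrence for c(n,k) and the r-Bell
-- recurrence B_r(k+1) = r B_r(k) + B_{r+1}(k), the sum Σ_k c(n,k) B_r(k) satisfies the same
-- recurrence, and B_0 = B.

open import Defs
open import Data.Bool using (Bool; true; false; T; _∧_; _∨_; not; if_then_else_)
open import Data.Bool.ListAction using (all)
open import Data.Bool.Properties using (∨-zeroʳ; T-≡; T-∧)
open import Data.Empty using (⊥; ⊥-elim)
open import Data.Fin using (Fin; toℕ; fromℕ) renaming (zero to fzero; suc to fsuc)
open import Data.Fin.Properties using (toℕ-injective; toℕ<n; ≤fromℕ)
open import Data.List
  using (List; []; _∷_; _++_; foldr; reverse; drop; zip; applyUpTo; map; concatMap; length; filterᵇ; allFin)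
open import Data.List.Membership.Propositional using (_∈_; lose)
open import Data.List.Membership.Propositional.Properties using (∈-allFin; ∈-++⁺ʳ; ∈-++⁺ˡ; ∈-map⁺)
open import Data.List.Properties using (map-tabulate; map-cong; unfold-reverse; reverse-++)
open import Data.List.Relation.Unary.All as All using (All)
open import Data.List.Relation.Unary.All.Properties as Allₚ using (all⁺; all⁻; tabulate⁺; ¬All⇒Any¬)
open import Data.List.Relation.Unary.AllPairs as AllPairs using (AllPairs)
import Data.List.Relation.Unary.AllPairs.Properties as AllPairsₚ
open import Data.List.Relation.Unary.Any as Any using (Any; here; there)
open import Data.List.Relation.Unary.Any.Properties using (any⁺; any⁻)
open import Data.Maybe using (Maybe; nothing; just; is-nothing)
open import Data.Nat using (ℕ; zero; suc; _+_; _*_; _<ᵇ_; _<_; _>_; _≤_; z≤n; s≤s; z<s; s<s)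
open import Data.Nat.ListAction using (sum; product)
open import Data.Nat.Properties
open import Data.Nat.Tactic.RingSolver using (solve-∀)
open import Data.Product using (_×_; _,_; proj₁; proj₂; ∃)
open import Data.Unit using (tt)
open import Data.Vec using (Vec; lookup; tabulate) renaming ([] to []ᵛ; _∷_ to _∷ᵛ_; map to mapᵛ)
open import Data.Vec.Properties using (∷-injectiveˡ; ∷-injectiveʳ; lookup-map; tabulate∘lookup; tabulate-cong)
open import Function using (_∘_; Equivalence)
open import Relation.Binary.Definitions using (tri<; tri≈; tri>)
open import Relation.Binary.PropositionalEquality
  using (_≡_; _≢_; refl; sym; trans; cong; cong₂; subst; module ≡-Reasoning)
open import Relation.Nullary using (¬_; contradiction; decidable-stable)
open import Relation.Nullary.Decidable using (T?)
open import Algebra.Properties.CommutativeSemigroup +-commutativeSemigroup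
  using () renaming (interchange to +-interchange)
open ≡-Reasoning

-- Finite sums and the Stirling–Bell identity

∑< : ℕ → (ℕ → ℕ) → ℕ
∑< N f = sum (applyUpTo f N)

∑<-cong : ∀ N {f g : ℕ → ℕ} → (∀ k → f k ≡ g k) → ∑< N f ≡ ∑< N g
∑<-cong zero    f≗g = refl
∑<-cong (suc N) f≗g = cong₂ _+_ (f≗g 0) (∑<-cong N (f≗g ∘ suc))

∑<-distrib-+ : ∀ N (f g : ℕ → ℕ) → ∑< N (λ k → f k + g k) ≡ ∑< N f + ∑< N g
∑<-distrib-+ zero    f g = refl
∑<-distrib-+ (suc N) f g = begin
  f 0 + g 0 + ∑< N (λ k → f (suc k) + g (suc k)) ≡⟨ cong (f 0 + g 0 +_) (∑<-distrib-+ N (f ∘ suc) (g ∘ suc)) ⟩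
  f 0 + g 0 + (∑< N (f ∘ suc) + ∑< N (g ∘ suc))  ≡⟨ +-interchange (f 0) (g 0) _ _ ⟩
  f 0 + ∑< N (f ∘ suc) + (g 0 + ∑< N (g ∘ suc))  ∎

∑<-distribˡ-* : ∀ N c (f : ℕ → ℕ) → ∑< N (λ k → c * f k) ≡ c * ∑< N f
∑<-distribˡ-* zero    c f = sym (*-zeroʳ c)
∑<-distribˡ-* (suc N) c f = trans (cong (c * f 0 +_) (∑<-distribˡ-* N c (f ∘ suc)))
                                  (sym (*-distribˡ-+ c (f 0) _))

∑<-suc : ∀ N (f : ℕ → ℕ) → ∑< (suc N) f ≡ ∑< N f + f N
∑<-suc zero    f = +-comm (f 0) 0
∑<-suc (suc N) f = trans (cong (f 0 +_) (∑<-suc N (f ∘ suc))) (sym (+-assoc (f 0) _ _))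

∑<-suc-vanishing : ∀ N (f : ℕ → ℕ) → f N ≡ 0 → ∑< (suc N) f ≡ ∑< N f
∑<-suc-vanishing N f fN≡0 = trans (∑<-suc N f) (trans (cong (∑< N f +_) fN≡0) (+-identityʳ _))

stirling1-vanishes : ∀ {n k} → n < k → stirling1 n k ≡ 0
stirling1-vanishes {zero}  {suc k} _         = refl
stirling1-vanishes {suc n} {suc k} (s<s n<k) = begin
  n * stirling1 n (suc k) + stirling1 n k
    ≡⟨ cong₂ (λ a b → n * a + b) (stirling1-vanishes (m<n⇒m<1+n n<k)) (stirling1-vanishes n<k) ⟩
  n * 0 + 0 ≡⟨ cong (_+ 0) (*-zeroʳ n) ⟩
  0         ∎

n*stirling1[n,0]≡0 : ∀ n → n * stirling1 n 0 ≡ 0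
n*stirling1[n,0]≡0 zero    = refl
n*stirling1[n,0]≡0 (suc n) = *-zeroʳ (suc n)

stirling1Sum : ℕ → (ℕ → ℕ) → ℕ
stirling1Sum n g = ∑< (suc n) (λ k → stirling1 n k * g k)

stirling1Sum-cong : ∀ n {g h : ℕ → ℕ} → (∀ k → g k ≡ h k) → stirling1Sum n g ≡ stirling1Sum n h
stirling1Sum-cong n g≗h = ∑<-cong (suc n) (λ k → cong (stirling1 n k *_) (g≗h k))

stirling1Sum-linear : ∀ n c (g h : ℕ → ℕ) →
  stirling1Sum n (λ k → c * g k + h k) ≡ c * stirling1Sum n g + stirling1Sum n h
stirling1Sum-linear n c g h = begin
  ∑< (suc n) (λ k → stirling1 n k * (c * g k + h k))
    ≡⟨ ∑<-cong (suc n) (λ k → distrib (stirling1 n k) c (g k) (h k)) ⟩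
  ∑< (suc n) (λ k → c * (stirling1 n k * g k) + stirling1 n k * h k)
    ≡⟨ ∑<-distrib-+ (suc n) (λ k → c * (stirling1 n k * g k)) (λ k → stirling1 n k * h k) ⟩
  ∑< (suc n) (λ k → c * (stirling1 n k * g k)) + stirling1Sum n h
    ≡⟨ cong (_+ stirling1Sum n h) (∑<-distribˡ-* (suc n) c (λ k → stirling1 n k * g k)) ⟩
  c * stirling1Sum n g + stirling1Sum n h ∎
  where
  distrib : ∀ s c x y → s * (c * x + y) ≡ c * (s * x) + s * y
  distrib = solve-∀

-- The Stirling recurrence c(n+1,k+1) = n c(n,k+1) + c(n,k), summed against g.
stirling1Sum-suc : ∀ n (g : ℕ → ℕ) → stirling1Sum (suc n) g ≡ n * stirling1Sum n g + stirling1Sum n (g ∘ suc)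
stirling1Sum-suc n g = begin
  ∑< (suc n) (λ k → (n * stirling1 n (suc k) + stirling1 n k) * g (suc k))
    ≡⟨ ∑<-cong (suc n) (λ k → distrib n (stirling1 n (suc k)) (stirling1 n k) (g (suc k))) ⟩
  ∑< (suc n) (λ k → n * shifted k + stirling1 n k * g (suc k))
    ≡⟨ ∑<-distrib-+ (suc n) (λ k → n * shifted k) (λ k → stirling1 n k * g (suc k)) ⟩
  ∑< (suc n) (λ k → n * shifted k) + stirling1Sum n (g ∘ suc)
    ≡⟨ cong (_+ stirling1Sum n (g ∘ suc)) (∑<-distribˡ-* (suc n) n shifted) ⟩
  n * ∑< (suc n) shifted + stirling1Sum n (g ∘ suc)
    ≡⟨ cong (λ x → n * x + stirling1Sum n (g ∘ suc)) (∑<-suc-vanishing n shifted top-vanishes) ⟩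
  n * ∑< n shifted + stirling1Sum n (g ∘ suc)
    ≡⟨ cong (_+ stirling1Sum n (g ∘ suc)) (sym n*sum≡) ⟩
  n * stirling1Sum n g + stirling1Sum n (g ∘ suc) ∎
  where
  shifted : ℕ → ℕ
  shifted k = stirling1 n (suc k) * g (suc k)
  distrib : ∀ n s t x → (n * s + t) * x ≡ n * (s * x) + t * x
  distrib = solve-∀
  top-vanishes : shifted n ≡ 0
  top-vanishes = cong (_* g (suc n)) (stirling1-vanishes (n<1+n n))
  n*sum≡ : n * stirling1Sum n g ≡ n * ∑< n shifted
  n*sum≡ = begin
    n * (stirling1 n 0 * g 0 + ∑< n shifted)     ≡⟨ *-distribˡ-+ n _ _ ⟩
    n * (stirling1 n 0 * g 0) + n * ∑< n shifted ≡⟨ cong (_+ n * ∑< n shifted) (sym (*-assoc n _ (g 0))) ⟩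
    n * stirling1 n 0 * g 0 + n * ∑< n shifted   ≡⟨ cong (λ x → x * g 0 + n * ∑< n shifted) (n*stirling1[n,0]≡0 n) ⟩
    n * ∑< n shifted ∎

-- rStirling2 r k j is the r-Stirling number of the second kind {k+r, j+r}_r
-- (partitions of [k+r] into j+r blocks with 1,…,r in distinct blocks),
-- and rBell r k the r-Bell number: the number of such partitions into any number of blocks.
rStirling2 : ℕ → ℕ → ℕ → ℕ
rStirling2 r zero    zero    = 1
rStirling2 r zero    (suc j) = 0
rStirling2 r (suc k) zero    = r * rStirling2 r k zero
rStirling2 r (suc k) (suc j) = (r + suc j) * rStirling2 r k (suc j) + rStirling2 r k j

rBell : ℕ → ℕ → ℕ
rBell r k = ∑< (suc k) (rStirling2 r k)

rStirling2-0≡stirling2 : ∀ k j → rStirling2 0 k j ≡ stirling2 k j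
rStirling2-0≡stirling2 zero    zero    = refl
rStirling2-0≡stirling2 zero    (suc j) = refl
rStirling2-0≡stirling2 (suc k) zero    = refl
rStirling2-0≡stirling2 (suc k) (suc j) =
  cong₂ (λ a b → suc j * a + b) (rStirling2-0≡stirling2 k (suc j)) (rStirling2-0≡stirling2 k j)

rStirling2-vanishes : ∀ r {k j} → k < j → rStirling2 r k j ≡ 0
rStirling2-vanishes r {zero}  {suc j} _         = refl
rStirling2-vanishes r {suc k} {suc j} (s<s k<j) = begin
  (r + suc j) * rStirling2 r k (suc j) + rStirling2 r k j
    ≡⟨ cong₂ (λ a b → (r + suc j) * a + b) (rStirling2-vanishes r (m<n⇒m<1+n k<j)) (rStirling2-vanishes r k<j) ⟩
  (r + suc j) * 0 + 0 ≡⟨ cong (_+ 0) (*-zeroʳ (r + suc j)) ⟩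
  0                   ∎

rStirling2-suc-r : ∀ r k j → rStirling2 (suc r) k j ≡ suc j * rStirling2 r k (suc j) + rStirling2 r k j
rStirling2-suc-r r zero    zero    = refl
rStirling2-suc-r r zero    (suc j) = sym (trans (+-identityʳ _) (*-zeroʳ (suc (suc j))))
rStirling2-suc-r r (suc k) zero    =
  trans (cong (suc r *_) (rStirling2-suc-r r k 0)) (identity r (rStirling2 r k 1) (rStirling2 r k 0))
  where
  identity : ∀ r x y → suc r * (1 * x + y) ≡ 1 * ((r + 1) * x + y) + r * y
  identity = solve-∀
rStirling2-suc-r r (suc k) (suc j) =
  trans (cong₂ (λ a b → (suc r + suc j) * a + b) (rStirling2-suc-r r k (suc j)) (rStirling2-suc-r r k j))
        (identity r j (rStirling2 r k (suc (suc j))) (rStirling2 r k (suc j)) (rStirling2 r k j))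
  where
  identity : ∀ r j x y z → (suc r + suc j) * (suc (suc j) * x + y) + (suc j * y + z)
                         ≡ suc (suc j) * ((r + suc (suc j)) * x + y) + ((r + suc j) * y + z)
  identity = solve-∀

rBell-suc : ∀ r k → rBell r (suc k) ≡ r * rBell r k + rBell (suc r) k
rBell-suc r k = begin
  r * S 0 + ∑< (suc k) (λ j → (r + suc j) * S (suc j) + S j)
    ≡⟨ cong (r * S 0 +_) (∑<-cong (suc k) split) ⟩
  r * S 0 + ∑< (suc k) (λ j → r * S (suc j) + rStirling2 (suc r) k j)
    ≡⟨ cong (r * S 0 +_) (∑<-distrib-+ (suc k) (λ j → r * S (suc j)) (rStirling2 (suc r) k)) ⟩
  r * S 0 + (∑< (suc k) (λ j → r * S (suc j)) + rBell (suc r) k)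
    ≡⟨ cong (λ x → r * S 0 + (x + rBell (suc r) k)) (∑<-distribˡ-* (suc k) r (S ∘ suc)) ⟩
  r * S 0 + (r * ∑< (suc k) (S ∘ suc) + rBell (suc r) k)
    ≡⟨ cong (λ x → r * S 0 + (r * x + rBell (suc r) k)) (∑<-suc-vanishing k (S ∘ suc) (rStirling2-vanishes r (n<1+n k))) ⟩
  r * S 0 + (r * ∑< k (S ∘ suc) + rBell (suc r) k)
    ≡⟨ sym (+-assoc (r * S 0) _ _) ⟩
  r * S 0 + r * ∑< k (S ∘ suc) + rBell (suc r) k
    ≡⟨ cong (_+ rBell (suc r) k) (sym (*-distribˡ-+ r (S 0) _)) ⟩
  r * rBell r k + rBell (suc r) k ∎
  where
  S : ℕ → ℕ
  S = rStirling2 r k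
  regroup : ∀ r j x y → (r + suc j) * x + y ≡ r * x + (suc j * x + y)
  regroup = solve-∀
  split : ∀ j → (r + suc j) * S (suc j) + S j ≡ r * S (suc j) + rStirling2 (suc r) k j
  split j = trans (regroup r j (S (suc j)) (S j)) (cong (r * S (suc j) +_) (sym (rStirling2-suc-r r k j)))

bell≡rBell0 : ∀ k → bell k ≡ rBell 0 k
bell≡rBell0 k = ∑<-cong (suc k) (λ j → sym (rStirling2-0≡stirling2 k j))

stirling1Sum-rBell-suc : ∀ n r →
  stirling1Sum (suc n) (rBell r) ≡ stirling1Sum n (rBell (suc r)) + (r + n) * stirling1Sum n (rBell r)
stirling1Sum-rBell-suc n r = begin
  stirling1Sum (suc n) (rBell r)
    ≡⟨ stirling1Sum-suc n (rBell r) ⟩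
  n * t + stirling1Sum n (rBell r ∘ suc)
    ≡⟨ cong (n * t +_) (trans (stirling1Sum-cong n (rBell-suc r)) (stirling1Sum-linear n r (rBell r) (rBell (suc r)))) ⟩
  n * t + (r * t + stirling1Sum n (rBell (suc r)))
    ≡⟨ regroup n r t _ ⟩
  stirling1Sum n (rBell (suc r)) + (r + n) * t ∎
  where
  t : ℕ
  t = stirling1Sum n (rBell r)
  regroup : ∀ n r t u → n * t + (r * t + u) ≡ u + (r + n) * t
  regroup = solve-∀

bellStirlingSum≡stirling1Sum-bell : ∀ m → bellStirlingSum (suc m) ≡ stirling1Sum (suc m) (rBell 0)
bellStirlingSum≡stirling1Sum-bell m = ∑<-cong (suc m) (λ j →
  trans (*-comm (bell (suc j)) (stirling1 (suc m) (suc j))) (cong (stirling1 (suc m) (suc j) *_) (bell≡rBell0 (suc j))))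

private variable
  A B : Set

sumBy : (A → ℕ) → List A → ℕ
sumBy f xs = sum (map f xs)

prodBy : (A → ℕ) → List A → ℕ
prodBy f xs = product (map f xs)

indicator : Bool → ℕ
indicator b = if b then 1 else 0

count : (A → Bool) → List A → ℕ
count P = sumBy (indicator ∘ P)

length-filterᵇ≡count : (P : A → Bool) (xs : List A) → length (filterᵇ P xs) ≡ count P xs
length-filterᵇ≡count P []       = refl
length-filterᵇ≡count P (x ∷ xs) with P x
... | true  = cong suc (length-filterᵇ≡count P xs)
... | false = length-filterᵇ≡count P xs

sumBy-cong : ∀ {f g : A → ℕ} xs → (∀ x → f x ≡ g x) → sumBy f xs ≡ sumBy g xs
sumBy-cong xs f≗g = cong sum (map-cong f≗g xs)

prodBy-cong : ∀ {f g : A → ℕ} xs → (∀ x → f x ≡ g x) → prodBy f xs ≡ prodBy g xs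
prodBy-cong xs f≗g = cong product (map-cong f≗g xs)

all-cong : ∀ {F G : A → Bool} xs → (∀ x → F x ≡ G x) → all F xs ≡ all G xs
all-cong xs F≗G = cong (foldr _∧_ true) (map-cong F≗G xs)

count-cong : ∀ {P Q : A → Bool} xs → (∀ x → P x ≡ Q x) → count P xs ≡ count Q xs
count-cong xs P≗Q = sumBy-cong xs (cong indicator ∘ P≗Q)

sumBy-distrib-+ : ∀ (f g : A → ℕ) xs → sumBy (λ x → f x + g x) xs ≡ sumBy f xs + sumBy g xs
sumBy-distrib-+ f g []       = refl
sumBy-distrib-+ f g (x ∷ xs) = trans (cong (f x + g x +_) (sumBy-distrib-+ f g xs)) (+-interchange (f x) (g x) _ _)

sumBy-distribˡ-* : ∀ c (f : A → ℕ) xs → sumBy (λ x → c * f x) xs ≡ c * sumBy f xs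
sumBy-distribˡ-* c f []       = sym (*-zeroʳ c)
sumBy-distribˡ-* c f (x ∷ xs) = trans (cong (c * f x +_) (sumBy-distribˡ-* c f xs)) (sym (*-distribˡ-+ c (f x) _))

sumBy-distribʳ-* : ∀ c (f : A → ℕ) xs → sumBy (λ x → f x * c) xs ≡ sumBy f xs * c
sumBy-distribʳ-* c f xs = begin
  sumBy (λ x → f x * c) xs ≡⟨ sumBy-cong xs (λ x → *-comm (f x) c) ⟩
  sumBy (λ x → c * f x) xs ≡⟨ sumBy-distribˡ-* c f xs ⟩
  c * sumBy f xs           ≡⟨ *-comm c _ ⟩
  sumBy f xs * c           ∎

sumBy-++ : ∀ (f : A → ℕ) xs ys → sumBy f (xs ++ ys) ≡ sumBy f xs + sumBy f ys
sumBy-++ f []       ys = refl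
sumBy-++ f (x ∷ xs) ys = trans (cong (f x +_) (sumBy-++ f xs ys)) (sym (+-assoc (f x) _ _))

sumBy-comm : (g : A → B → ℕ) (xs : List A) (ys : List B) →
  sumBy (λ x → sumBy (g x) ys) xs ≡ sumBy (λ y → sumBy (λ x → g x y) xs) ys
sumBy-comm g []       ys = sym (sumBy-distribˡ-* 0 (λ _ → 0) ys)
sumBy-comm g (x ∷ xs) ys = begin
  sumBy (g x) ys + sumBy (λ x → sumBy (g x) ys) xs
    ≡⟨ cong (sumBy (g x) ys +_) (sumBy-comm g xs ys) ⟩
  sumBy (g x) ys + sumBy (λ y → sumBy (λ x → g x y) xs) ys
    ≡⟨ sym (sumBy-distrib-+ (g x) (λ y → sumBy (λ x → g x y) xs) ys) ⟩
  sumBy (λ y → g x y + sumBy (λ x → g x y) xs) ys ∎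

count-none : ∀ (P : A → Bool) xs → (∀ x → ¬ T (P x)) → count P xs ≡ 0
count-none P []       never = refl
count-none P (x ∷ xs) never with P x in eq
... | true  = ⊥-elim (never x (subst T (sym eq) _))
... | false = count-none P xs never

count-∧ : ∀ b (P : A → Bool) xs → count (λ x → b ∧ P x) xs ≡ indicator b * count P xs
count-∧ true  P xs = sym (+-identityʳ _)
count-∧ false P xs = count-none (λ _ → false) xs (λ _ ())

sumBy-map : (f : B → ℕ) (g : A → B) (xs : List A) → sumBy f (map g xs) ≡ sumBy (f ∘ g) xs
sumBy-map f g []       = refl
sumBy-map f g (x ∷ xs) = cong (f (g x) +_) (sumBy-map f g xs)

sumBy-concatMap : (f : B → ℕ) (g : A → List B) (xs : List A) →
  sumBy f (concatMap g xs) ≡ sumBy (λ x → sumBy f (g x)) xs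
sumBy-concatMap f g []       = refl
sumBy-concatMap f g (x ∷ xs) = trans (sumBy-++ f (g x) (concatMap g xs)) (cong (sumBy f (g x) +_) (sumBy-concatMap f g xs))

sumBy-allVecs-suc : (xs : List A) (n : ℕ) (f : Vec A (suc n) → ℕ) →
  sumBy f (allVecs xs (suc n)) ≡ sumBy (λ x → sumBy (λ v → f (x ∷ᵛ v)) (allVecs xs n)) xs
sumBy-allVecs-suc xs n f =
  trans (sumBy-concatMap f (λ x → map (x ∷ᵛ_) (allVecs xs n)) xs)
        (sumBy-cong xs (λ x → sumBy-map f (x ∷ᵛ_) (allVecs xs n)))

map-allFin-suc : (n : ℕ) (f : Fin (suc n) → A) → map f (allFin (suc n)) ≡ f fzero ∷ map (f ∘ fsuc) (allFin n)
map-allFin-suc n f = cong (f fzero ∷_) (trans (map-tabulate fsuc f) (sym (map-tabulate (λ i → i) (f ∘ fsuc))))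

module _ {n : ℕ} where

  all-allFin-suc : (F : Fin (suc n) → Bool) → all F (allFin (suc n)) ≡ F fzero ∧ all (F ∘ fsuc) (allFin n)
  all-allFin-suc F = cong (foldr _∧_ true) (map-allFin-suc n F)

  sumBy-allFin-suc : (f : Fin (suc n) → ℕ) → sumBy f (allFin (suc n)) ≡ f fzero + sumBy (f ∘ fsuc) (allFin n)
  sumBy-allFin-suc f = cong sum (map-allFin-suc n f)

  prodBy-allFin-suc : (f : Fin (suc n) → ℕ) → prodBy f (allFin (suc n)) ≡ f fzero * prodBy (f ∘ fsuc) (allFin n)
  prodBy-allFin-suc f = cong product (map-allFin-suc n f)

  count-allFin-suc : (F : Fin (suc n) → Bool) → count F (allFin (suc n)) ≡ indicator (F fzero) + count (F ∘ fsuc) (allFin n)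
  count-allFin-suc F = sumBy-allFin-suc (indicator ∘ F)

  all-allFin⁻ : (F : Fin n → Bool) → T (all F (allFin n)) → ∀ i → T (F i)
  all-allFin⁻ F allF i = All.lookup (all⁺ F (allFin n) allF) (∈-allFin i)

  all-allFin⁺ : (F : Fin n → Bool) → (∀ i → T (F i)) → T (all F (allFin n))
  all-allFin⁺ F F-holds = all⁻ F (tabulate⁺ F-holds)

count-allFin-true : ∀ n → count (λ (_ : Fin n) → true) (allFin n) ≡ n
count-allFin-true zero    = refl
count-allFin-true (suc n) = trans (count-allFin-suc {n} (λ _ → true)) (cong suc (count-allFin-true n))

count-allVecs-pointwise : (xs : List A) (n : ℕ) (R : Fin n → A → Bool) →
  count (λ p → all (λ v → R v (lookup p v)) (allFin n)) (allVecs xs n) ≡ prodBy (λ v → count (R v) xs) (allFin n)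
count-allVecs-pointwise xs zero    R = refl
count-allVecs-pointwise xs (suc n) R = begin
  count (λ p → all (λ v → R v (lookup p v)) (allFin (suc n))) (allVecs xs (suc n))
    ≡⟨ sumBy-allVecs-suc xs n _ ⟩
  sumBy (λ x → count (λ p → all (λ v → R v (lookup (x ∷ᵛ p) v)) (allFin (suc n))) (allVecs xs n)) xs
    ≡⟨ sumBy-cong xs (λ x → count-cong (allVecs xs n) (λ p → all-allFin-suc (λ v → R v (lookup (x ∷ᵛ p) v)))) ⟩
  sumBy (λ x → count (λ p → R fzero x ∧ all (λ v → R (fsuc v) (lookup p v)) (allFin n)) (allVecs xs n)) xs
    ≡⟨ sumBy-cong xs (λ x → trans (count-∧ (R fzero x) _ (allVecs xs n))
                                  (cong (indicator (R fzero x) *_) (count-allVecs-pointwise xs n (R ∘ fsuc)))) ⟩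
  sumBy (λ x → indicator (R fzero x) * prodBy (λ v → count (R (fsuc v)) xs) (allFin n)) xs
    ≡⟨ sumBy-distribʳ-* _ (indicator ∘ R fzero) xs ⟩
  count (R fzero) xs * prodBy (λ v → count (R (fsuc v)) xs) (allFin n)
    ≡⟨ sym (prodBy-allFin-suc (λ v → count (R v) xs)) ⟩
  prodBy (λ v → count (R v) xs) (allFin (suc n)) ∎


T-ext : ∀ {a b} → (T a → T b) → (T b → T a) → a ≡ b
T-ext {false} {false} _ _ = refl
T-ext {false} {true}  _ g = contradiction tt g
T-ext {true}  {false} f _ = contradiction tt f
T-ext {true}  {true}  _ _ = refl

T-not⇒¬T : ∀ {b} → T (not b) → ¬ T b
T-not⇒¬T {false} _ ()

¬T⇒T-not : ∀ {b} → ¬ T b → T (not b)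
¬T⇒T-not {false} _  = tt
¬T⇒T-not {true}  ¬t = ¬t tt

<ᵇ≡true : ∀ {a b} → a < b → (a <ᵇ b) ≡ true
<ᵇ≡true = Equivalence.to T-≡ ∘ <⇒<ᵇ

<ᵇ≡false : ∀ {a b} → b ≤ a → (a <ᵇ b) ≡ false
<ᵇ≡false {a} {b} b≤a with a <ᵇ b in eq
... | false = refl
... | true  = contradiction (<ᵇ⇒< a b (subst T (sym eq) tt)) (≤⇒≯ b≤a)

-- Patterns of length three

sameRelOrder-sorted : ∀ {a b c} → a < b → b < c →
  T (sameRelOrder (1 ∷ 2 ∷ 3 ∷ []) (a ∷ b ∷ c ∷ [])) ×
  T (sameRelOrder (2 ∷ 1 ∷ 3 ∷ []) (b ∷ a ∷ c ∷ [])) ×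
  T (sameRelOrder (3 ∷ 1 ∷ 2 ∷ []) (c ∷ a ∷ b ∷ []))
sameRelOrder-sorted {a} {b} {c} a<b b<c
  rewrite <ᵇ≡false {a} ≤-refl | <ᵇ≡false {b} ≤-refl | <ᵇ≡false {c} ≤-refl
        | <ᵇ≡true a<b | <ᵇ≡true b<c | <ᵇ≡true (<-trans a<b b<c)
        | <ᵇ≡false (<⇒≤ a<b) | <ᵇ≡false (<⇒≤ b<c) | <ᵇ≡false (<⇒≤ (<-trans a<b b<c)) = tt , tt , tt

sameRelOrder-pair : ∀ σ s {a b c d} → (a , b) ∈ zip σ s → (c , d) ∈ zip σ s →
  T (sameRelOrder σ s) → T ((a <ᵇ c) ==ᴮ (b <ᵇ d))
sameRelOrder-pair σ s ab∈ cd∈ same =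
  All.lookup (all⁺ _ (zip σ s) (All.lookup (all⁺ _ (zip σ s) (proj₂ (Equivalence.to T-∧ same))) ab∈)) cd∈

sameRelOrder-middle : ∀ {x y z a b c} → T (y <ᵇ z) → T (sameRelOrder (x ∷ y ∷ z ∷ []) (a ∷ b ∷ c ∷ [])) → b < c
sameRelOrder-middle {x} {y} {z} {a} {b} {c} y<z same =
  <ᵇ⇒< b c (agree (y <ᵇ z) y<z
    (sameRelOrder-pair (x ∷ y ∷ z ∷ []) (a ∷ b ∷ c ∷ []) (there (here refl)) (there (there (here refl))) same))
  where
  agree : ∀ q {r} → T q → T (q ==ᴮ r) → T r
  agree true _ r = r

subseqs-All : ∀ {P : A → Set} {xs} → All P xs → All (All P) (subseqs xs)
subseqs-All {xs = []}     All.[]         = All.[] All.∷ All.[]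
subseqs-All {xs = x ∷ xs} (px All.∷ pxs) =
  Allₚ.++⁺ (Allₚ.map⁺ (All.map (px All.∷_) (subseqs-All pxs))) (subseqs-All pxs)

subseqs-AllPairs : ∀ {R : A → A → Set} {xs} → AllPairs R xs → All (AllPairs R) (subseqs xs)
subseqs-AllPairs {xs = []}     AllPairs.[]       = AllPairs.[] All.∷ All.[]
subseqs-AllPairs {xs = x ∷ xs} (rx AllPairs.∷ rxs) =
  Allₚ.++⁺ (Allₚ.map⁺ (All.zipWith (λ (a , b) → a AllPairs.∷ b) (subseqs-All rx , subseqs-AllPairs rxs)))
           (subseqs-AllPairs rxs)

subseqs-self : ∀ (xs : List A) → xs ∈ subseqs xs
subseqs-self []       = here refl
subseqs-self (x ∷ xs) = ∈-++⁺ˡ (∈-map⁺ (x ∷_) (subseqs-self xs))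

subseqs-++ʳ : ∀ (xs : List A) {ys s} → s ∈ subseqs ys → s ∈ subseqs (xs ++ ys)
subseqs-++ʳ []       s∈ = s∈
subseqs-++ʳ (x ∷ xs) s∈ = ∈-++⁺ʳ (map (x ∷_) (subseqs (xs ++ _))) (subseqs-++ʳ xs s∈)

containsPattern-suffix : ∀ σ xs s → T (sameRelOrder σ s) → T (containsPattern σ (xs ++ s))
containsPattern-suffix σ xs s same = any⁺ _ (lose (subseqs-++ʳ xs (subseqs-self s)) same)

-- Every pattern x y z with y < z needs an ascent after its first entry.
descending-avoids : ∀ {x y z} → T (y <ᵇ z) → ∀ t {d} → AllPairs _>_ d →
  ¬ T (containsPattern (x ∷ y ∷ z ∷ []) (t ∷ d))
descending-avoids {x} {y} {z} y<z t {d} desc contains =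
  noMatch (Any.lookup match) (All.lookupAny tailsDescend match)
  where
  match : Any (T ∘ sameRelOrder (x ∷ y ∷ z ∷ [])) (subseqs (t ∷ d))
  match = any⁻ (sameRelOrder (x ∷ y ∷ z ∷ [])) (subseqs (t ∷ d)) contains
  tailsDescend : All (λ s → AllPairs _>_ (drop 1 s)) (subseqs (t ∷ d))
  tailsDescend = Allₚ.++⁺ (Allₚ.map⁺ (subseqs-AllPairs desc)) (All.map (AllPairsₚ.drop⁺ 1) (subseqs-AllPairs desc))
  noMatch : ∀ s → ¬ (AllPairs _>_ (drop 1 s) × T (sameRelOrder (x ∷ y ∷ z ∷ []) s))
  noMatch (a ∷ b ∷ c ∷ []) (((c<b All.∷ All.[]) AllPairs.∷ _) , same) =
    <-asym c<b (sameRelOrder-middle {x} {y} {z} {a} y<z same)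

forbidden : List (List ℕ)
forbidden = (3 ∷ 1 ∷ 2 ∷ []) ∷ (2 ∷ 1 ∷ 3 ∷ []) ∷ (1 ∷ 2 ∷ 3 ∷ []) ∷ []

forbidden-triple : ∀ {a b c} → b < c → a ≢ b → a ≢ c →
  Any (λ σ → T (sameRelOrder σ (a ∷ b ∷ c ∷ []))) forbidden
forbidden-triple {a} {b} {c} b<c a≢b a≢c with <-cmp a b | <-cmp a c
... | tri< a<b _ _ | _            = there (there (here (proj₁ (sameRelOrder-sorted a<b b<c))))
... | tri≈ _ a≡b _ | _            = contradiction a≡b a≢b
... | tri> _ _ b<a | tri< a<c _ _ = there (here (proj₁ (proj₂ (sameRelOrder-sorted b<a a<c))))
... | tri> _ _ _   | tri≈ _ a≡c _ = contradiction a≡c a≢c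
... | tri> _ _ _   | tri> _ _ c<a = here (proj₂ (proj₂ (sameRelOrder-sorted b<c c<a)))

-- Counting admissible parent maps

module _ {n : ℕ} where

  admissibleParent : ParentMap n → Fin n → Maybe (Fin n) → Bool
  admissibleParent p v nothing  = true
  admissibleParent p v (just u) = is-nothing (lookup p u) ∨ (toℕ v <ᵇ toℕ u)

  admissibleAt : ParentMap n → Fin n → Bool
  admissibleAt p v = admissibleParent p v (lookup p v)

  admissible : ParentMap n → Bool
  admissible p = all (admissibleAt p) (allFin n)

  rootMarking : ParentMap n → Vec Bool n
  rootMarking = mapᵛ is-nothing

  consistentParent : Vec Bool n → Fin n → Maybe (Fin n) → Bool
  consistentParent b v nothing  = lookup b v
  consistentParent b v (just u) = not (lookup b v) ∧ (lookup b u ∨ (toℕ v <ᵇ toℕ u))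

  consistent : Vec Bool n → ParentMap n → Bool
  consistent b p = all (λ v → consistentParent b v (lookup p v)) (allFin n)

  consistentParent⇒marking : ∀ b v m → T (consistentParent b v m) → lookup b v ≡ is-nothing m
  consistentParent⇒marking b v nothing  bv = Equivalence.to T-≡ bv
  consistentParent⇒marking b v (just u) ok with lookup b v
  ... | false = refl

  consistent⇒rootMarking : ∀ b p → T (consistent b p) → b ≡ rootMarking p
  consistent⇒rootMarking b p ok = begin
    b                            ≡⟨ sym (tabulate∘lookup b) ⟩
    tabulate (lookup b)          ≡⟨ tabulate-cong marks ⟩
    tabulate (lookup (rootMarking p)) ≡⟨ tabulate∘lookup (rootMarking p) ⟩
    rootMarking p                ∎
    where
    marks : ∀ v → lookup b v ≡ lookup (rootMarking p) v
    marks v = trans (consistentParent⇒marking b v (lookup p v) (all-allFin⁻ _ ok v))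
                    (sym (lookup-map v is-nothing p))

  consistent-rootMarking : ∀ p → consistent (rootMarking p) p ≡ admissible p
  consistent-rootMarking p = all-cong (allFin n) (λ v → pointwise v (lookup p v) refl)
    where
    isRoot : ∀ v → lookup (rootMarking p) v ≡ is-nothing (lookup p v)
    isRoot v = lookup-map v is-nothing p
    pointwise : ∀ v m → lookup p v ≡ m → consistentParent (rootMarking p) v m ≡ admissibleParent p v m
    pointwise v nothing  pv≡m = trans (isRoot v) (cong is-nothing pv≡m)
    pointwise v (just u) pv≡m =
      cong₂ (λ x y → not x ∧ (y ∨ (toℕ v <ᵇ toℕ u))) (trans (isRoot v) (cong is-nothing pv≡m)) (isRoot u)

allBoolVecs : (n : ℕ) → List (Vec Bool n)
allBoolVecs = allVecs (true ∷ false ∷ [])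

module _ {n : ℕ} (h : Vec Bool (suc n) → Bool) {x b₀} (only : ∀ b → T (h b) → b ≡ x ∷ᵛ b₀) where

  only-tail : ∀ b → T (h (x ∷ᵛ b)) → b ≡ b₀
  only-tail b hb = ∷-injectiveʳ (only _ hb)

  count-other-head : ∀ y → y ≢ x → count (h ∘ (y ∷ᵛ_)) (allBoolVecs n) ≡ 0
  count-other-head y y≢x = count-none _ (allBoolVecs n) (λ b hb → y≢x (∷-injectiveˡ (only _ hb)))

count-allBoolVecs-unique : ∀ n (h : Vec Bool n → Bool) b₀ → (∀ b → T (h b) → b ≡ b₀) →
  count h (allBoolVecs n) ≡ indicator (h b₀)
count-allBoolVecs-unique zero    h []ᵛ          _    = +-identityʳ _
count-allBoolVecs-unique (suc n) h (true ∷ᵛ b₀)  only = begin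
  count h (allBoolVecs (suc n))
    ≡⟨ sumBy-allVecs-suc _ n (indicator ∘ h) ⟩
  count (h ∘ (true ∷ᵛ_)) (allBoolVecs n) + (count (h ∘ (false ∷ᵛ_)) (allBoolVecs n) + 0)
    ≡⟨ cong₂ (λ s t → s + (t + 0)) (count-allBoolVecs-unique n _ b₀ (only-tail h only))
                                   (count-other-head h only false λ ()) ⟩
  indicator (h (true ∷ᵛ b₀)) + 0
    ≡⟨ +-identityʳ _ ⟩
  indicator (h (true ∷ᵛ b₀)) ∎
count-allBoolVecs-unique (suc n) h (false ∷ᵛ b₀) only = begin
  count h (allBoolVecs (suc n))
    ≡⟨ sumBy-allVecs-suc _ n (indicator ∘ h) ⟩
  count (h ∘ (true ∷ᵛ_)) (allBoolVecs n) + (count (h ∘ (false ∷ᵛ_)) (allBoolVecs n) + 0)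
    ≡⟨ cong₂ (λ s t → s + (t + 0)) (count-other-head h only true λ ())
                                   (count-allBoolVecs-unique n _ b₀ (only-tail h only)) ⟩
  indicator (h (false ∷ᵛ b₀)) + 0
    ≡⟨ +-identityʳ _ ⟩
  indicator (h (false ∷ᵛ b₀)) ∎

indicator-admissible : ∀ {n} (p : ParentMap n) → indicator (admissible p) ≡ count (λ b → consistent b p) (allBoolVecs n)
indicator-admissible {n} p = sym (begin
  count (λ b → consistent b p) (allBoolVecs n)
    ≡⟨ count-allBoolVecs-unique n (λ b → consistent b p) (rootMarking p) (λ b → consistent⇒rootMarking b p) ⟩
  indicator (consistent (rootMarking p) p)
    ≡⟨ cong indicator (consistent-rootMarking p) ⟩
  indicator (admissible p) ∎)

-- With the roots marked by b and r further roots outside [n], the number of admissible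
-- choices of parent (or none) for v.
parentChoices : ∀ {n} → ℕ → Vec Bool n → Fin n → ℕ
parentChoices {n} r b v = if lookup b v then 1 else r + count (λ u → lookup b u ∨ (toℕ v <ᵇ toℕ u)) (allFin n)

count-consistentParent : ∀ {n} (b : Vec Bool n) v → count (consistentParent b v) (allMaybeFin n) ≡ parentChoices 0 b v
count-consistentParent {n} b v = begin
  indicator (lookup b v) + sumBy (indicator ∘ consistentParent b v) (map just (allFin n))
    ≡⟨ cong (indicator (lookup b v) +_) (trans (sumBy-map _ just (allFin n)) (count-∧ (not (lookup b v)) _ (allFin n))) ⟩
  indicator (lookup b v) + indicator (not (lookup b v)) * c
    ≡⟨ select (lookup b v) ⟩
  parentChoices 0 b v ∎
  where
  c : ℕ
  c = count (λ u → lookup b u ∨ (toℕ v <ᵇ toℕ u)) (allFin n)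
  select : ∀ x → indicator x + indicator (not x) * c ≡ (if x then 1 else c)
  select true  = refl
  select false = +-identityʳ c

markedCount : ℕ → ℕ → ℕ
markedCount n r = sumBy (λ b → prodBy (parentChoices r b) (allFin n)) (allBoolVecs n)

module _ {n : ℕ} (r : ℕ) (b : Vec Bool n) where

  parentChoices-true∷ : ∀ i → parentChoices r (true ∷ᵛ b) (fsuc i) ≡ parentChoices (suc r) b i
  parentChoices-true∷ i = cong (if_then_else_ (lookup b i) 1)
    (trans (cong (r +_) (count-allFin-suc (λ u → lookup (true ∷ᵛ b) u ∨ (suc (toℕ i) <ᵇ toℕ u))))
           (+-suc r _))

  parentChoices-false∷ : ∀ i → parentChoices r (false ∷ᵛ b) (fsuc i) ≡ parentChoices r b i
  parentChoices-false∷ i = cong (λ c → if lookup b i then 1 else r + c)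
    (count-allFin-suc (λ u → lookup (false ∷ᵛ b) u ∨ (suc (toℕ i) <ᵇ toℕ u)))

  parentChoices-false∷-zero : parentChoices r (false ∷ᵛ b) fzero ≡ r + n
  parentChoices-false∷-zero = cong (r +_) (begin
    count (λ u → lookup (false ∷ᵛ b) u ∨ (0 <ᵇ toℕ u)) (allFin (suc n))
      ≡⟨ count-allFin-suc (λ u → lookup (false ∷ᵛ b) u ∨ (0 <ᵇ toℕ u)) ⟩
    count (λ u → lookup b u ∨ true) (allFin n)
      ≡⟨ count-cong (allFin n) (λ u → ∨-zeroʳ (lookup b u)) ⟩
    count (λ _ → true) (allFin n)
      ≡⟨ count-allFin-true n ⟩
    n ∎)

-- The smallest vertex is either a root, which the others see as one more extra root,
-- or a non-root, whose parent can be any of the other n vertices or the r extra roots.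
markedCount-suc : ∀ n r → markedCount (suc n) r ≡ markedCount n (suc r) + (r + n) * markedCount n r
markedCount-suc n r = begin
  markedCount (suc n) r
    ≡⟨ sumBy-allVecs-suc _ n (λ b → prodBy (parentChoices r b) (allFin (suc n))) ⟩
  sumBy (λ b → prodBy (parentChoices r (true ∷ᵛ b)) (allFin (suc n))) (allBoolVecs n)
    + (sumBy (λ b → prodBy (parentChoices r (false ∷ᵛ b)) (allFin (suc n))) (allBoolVecs n) + 0)
    ≡⟨ cong₂ _+_ (sumBy-cong (allBoolVecs n) rootAtZero)
                 (trans (+-identityʳ _) (trans (sumBy-cong (allBoolVecs n) nonRootAtZero)
                                               (sumBy-distribˡ-* (r + n) (λ b → prodBy (parentChoices r b) (allFin n)) (allBoolVecs n)))) ⟩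
  markedCount n (suc r) + (r + n) * markedCount n r ∎
  where
  rootAtZero : ∀ b → prodBy (parentChoices r (true ∷ᵛ b)) (allFin (suc n)) ≡ prodBy (parentChoices (suc r) b) (allFin n)
  rootAtZero b = trans (prodBy-allFin-suc (parentChoices r (true ∷ᵛ b)))
                       (trans (*-identityˡ _) (prodBy-cong (allFin n) (parentChoices-true∷ r b)))
  nonRootAtZero : ∀ b →
    prodBy (parentChoices r (false ∷ᵛ b)) (allFin (suc n)) ≡ (r + n) * prodBy (parentChoices r b) (allFin n)
  nonRootAtZero b = trans (prodBy-allFin-suc (parentChoices r (false ∷ᵛ b)))
                          (cong₂ _*_ (parentChoices-false∷-zero r b) (prodBy-cong (allFin n) (parentChoices-false∷ r b)))

markedCount≡stirling1Sum : ∀ n r → markedCount n r ≡ stirling1Sum n (rBell r)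
markedCount≡stirling1Sum zero    r = refl
markedCount≡stirling1Sum (suc n) r = begin
  markedCount (suc n) r
    ≡⟨ markedCount-suc n r ⟩
  markedCount n (suc r) + (r + n) * markedCount n r
    ≡⟨ cong₂ (λ x y → x + (r + n) * y) (markedCount≡stirling1Sum n (suc r)) (markedCount≡stirling1Sum n r) ⟩
  stirling1Sum n (rBell (suc r)) + (r + n) * stirling1Sum n (rBell r)
    ≡⟨ sym (stirling1Sum-rBell-suc n r) ⟩
  stirling1Sum (suc n) (rBell r) ∎

count-admissible : ∀ n → count admissible (allParentMaps n) ≡ markedCount n 0
count-admissible n = begin
  count admissible (allParentMaps n)
    ≡⟨ sumBy-cong (allParentMaps n) indicator-admissible ⟩
  sumBy (λ p → count (λ b → consistent b p) (allBoolVecs n)) (allParentMaps n)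
    ≡⟨ sumBy-comm (λ p b → indicator (consistent b p)) (allParentMaps n) (allBoolVecs n) ⟩
  sumBy (λ b → count (consistent b) (allParentMaps n)) (allBoolVecs n)
    ≡⟨ sumBy-cong (allBoolVecs n) (λ b → count-allVecs-pointwise (allMaybeFin n) n (consistentParent b)) ⟩
  sumBy (λ b → prodBy (λ v → count (consistentParent b v) (allMaybeFin n)) (allFin n)) (allBoolVecs n)
    ≡⟨ sumBy-cong (allBoolVecs n) (λ b → prodBy-cong (allFin n) (count-consistentParent b)) ⟩
  markedCount n 0 ∎

-- Admissible parent maps are the forests avoiding 312, 213 and 123

largest : ∀ {n} → Fin n → Fin n
largest {suc n} _ = fromℕ n

largest-max : ∀ {n} (v u : Fin n) → toℕ u ≤ toℕ (largest v)
largest-max {suc n} _ u = ≤fromℕ u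

label-injective : ∀ {n} {x y : Fin n} → label x ≡ label y → x ≡ y
label-injective = toℕ-injective ∘ suc-injective

m<n⇒1+o+m≤o+n : ∀ o {m n} → m < n → suc o + m ≤ o + n
m<n⇒1+o+m≤o+n o {m} {n} m<n = subst (_≤ o + n) (+-suc o m) (+-monoʳ-≤ o m<n)

module _ {n : ℕ} (p : ParentMap n) where

  reachesRoot-step : ∀ {v u} f → lookup p v ≡ just u → reachesRoot p (suc f) v ≡ reachesRoot p f u
  reachesRoot-step {v} f pv with lookup p v
  reachesRoot-step {v} f refl | .(just _) = refl

  chainUp-step : ∀ {v u} f → lookup p v ≡ just u → chainUp p (suc f) v ≡ v ∷ chainUp p f u
  chainUp-step {v} f pv with lookup p v
  chainUp-step {v} f refl | .(just _) = refl

  chainUp-root : ∀ {v} f → lookup p v ≡ nothing → chainUp p f v ≡ v ∷ []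
  chainUp-root         zero    _  = refl
  chainUp-root {v} (suc f) pv with lookup p v
  chainUp-root {v} (suc f) refl | .nothing = refl

  reachesRoot-root : ∀ {v f} → lookup p v ≡ nothing → 0 < f → T (reachesRoot p f v)
  reachesRoot-root {v} {suc f} pv _ with lookup p v
  reachesRoot-root {v} {suc f} refl _ | .nothing = tt

  chainUp-head : ∀ f v → ∃ λ rest → chainUp p f v ≡ v ∷ rest
  chainUp-head zero    v = [] , refl
  chainUp-head (suc f) v with lookup p v
  ... | nothing = [] , refl
  ... | just u  = chainUp p f u , refl

  twoCycle-unreachable : ∀ {x y} → lookup p x ≡ just y → lookup p y ≡ just x → ∀ f → ¬ T (reachesRoot p f x)
  twoCycle-unreachable px py zero    ()
  twoCycle-unreachable px py (suc f) = twoCycle-unreachable py px f ∘ subst T (reachesRoot-step f px)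

  root≢nonRoot : ∀ {r v u} → lookup p r ≡ nothing → lookup p v ≡ just u → toℕ r ≢ toℕ v
  root≢nonRoot pr pv r≡v with toℕ-injective r≡v
  ... | refl with trans (sym pr) pv
  ... | ()

  module _ (adm : T (admissible p)) where

    admissible-step : ∀ {v u w} → lookup p v ≡ just u → lookup p u ≡ just w → toℕ v < toℕ u
    admissible-step {v} {u} pv pu = <ᵇ⇒< _ _
      (subst (λ m → T (is-nothing m ∨ (toℕ v <ᵇ toℕ u))) pu
        (subst (T ∘ admissibleParent p v) pv (all-allFin⁻ _ adm v)))

    -- The largest vertex is a root or hangs below one.
    root-exists : Fin n → ∃ λ r → lookup p r ≡ nothing
    root-exists v with lookup p (largest v) in ptop
    ... | nothing = largest v , ptop
    ... | just u with lookup p u in pu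
    ...   | nothing = u , pu
    ...   | just _  = contradiction (admissible-step ptop pu) (≤⇒≯ (largest-max v u))

    -- Up to its last step the path from v climbs strictly through [toℕ v, n) and misses
    -- the root r, so n ∸ toℕ v steps of fuel suffice, one more when r lies below v.
    reachesRoot-admissible : ∀ {r} → lookup p r ≡ nothing → ∀ f v →
      n ≤ f + toℕ v → (toℕ r < toℕ v → n < f + toℕ v) → T (reachesRoot p f v)
    reachesRoot-admissible pr zero    v n≤v _ = contradiction (toℕ<n v) (≤⇒≯ n≤v)
    reachesRoot-admissible {r} pr (suc f) v n≤ r<v⇒ with lookup p v in pv
    ... | nothing = tt
    ... | just u with lookup p u in pu
    ...   | nothing = reachesRoot-root pu (fuel-positive f n≤ r<v⇒)
      where
      fuel-positive : ∀ f → n ≤ suc f + toℕ v → (toℕ r < toℕ v → n < suc f + toℕ v) → 0 < f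
      fuel-positive zero    n≤ r<v⇒ = contradiction (toℕ<n v) (≤⇒≯ (≤-pred (r<v⇒ r<v)))
        where
        r<v : toℕ r < toℕ v
        r<v = ≤∧≢⇒< (≤-pred (≤-trans (toℕ<n r) n≤)) (root≢nonRoot pr pv)
      fuel-positive (suc f) _  _     = z<s
    ...   | just w  = reachesRoot-admissible pr f u (≤-trans n≤ (m<n⇒1+o+m≤o+n f v<u)) r<u⇒
      where
      v<u : toℕ v < toℕ u
      v<u = admissible-step pv pu
      r<u⇒ : toℕ r < toℕ u → n < f + toℕ u
      r<u⇒ r<u with <-cmp (toℕ r) (toℕ v)
      ... | tri< r<v _ _ = <-≤-trans (r<v⇒ r<v) (m<n⇒1+o+m≤o+n f v<u)
      ... | tri≈ _ r≡v _ = contradiction r≡v (root≢nonRoot pr pv)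
      ... | tri> _ _ v<r = ≤-trans (s≤s n≤)
        (subst (_≤ f + toℕ u) (+-suc (suc f) (toℕ v)) (m<n⇒1+o+m≤o+n f (≤-<-trans v<r r<u)))

    admissible⇒forest : T (isForest p)
    admissible⇒forest = all-allFin⁺ _ λ v →
      let (r , pr) = root-exists v
      in reachesRoot-admissible pr n v (m≤m+n n (toℕ v)) (λ r<v → m<m+n n (≤-<-trans z≤n r<v))

    chainUp-descending : ∀ f v → ∃ λ t → ∃ λ d →
      reverse (map label (chainUp p f v)) ≡ t ∷ d × AllPairs _>_ d × All (label v ≤_) d
    chainUp-descending zero    v = label v , [] , refl , AllPairs.[] , All.[]
    chainUp-descending (suc f) v with lookup p v in pv
    ... | nothing = label v , [] , refl , AllPairs.[] , All.[]
    ... | just u with lookup p u in pu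
    ...   | nothing rewrite chainUp-root f pu =
      label u , label v ∷ [] , refl , All.[] AllPairs.∷ AllPairs.[] , ≤-refl All.∷ All.[]
    ...   | just w with chainUp-descending f u
    ...     | t , d , path , desc , above-u = t , d ++ label v ∷ [] , path′ , desc′ , atLeast-v
      where
      above-v : All (label v <_) d
      above-v = All.map (<-≤-trans (s<s (admissible-step pv pu))) above-u
      path′ : reverse (label v ∷ map label (chainUp p f u)) ≡ t ∷ (d ++ label v ∷ [])
      path′ = trans (unfold-reverse (label v) (map label (chainUp p f u))) (cong (_++ label v ∷ []) path)
      desc′ : AllPairs _>_ (d ++ label v ∷ [])
      desc′ = AllPairsₚ.++⁺ desc (All.[] AllPairs.∷ AllPairs.[]) (All.map (All._∷ All.[]) above-v)
      atLeast-v : All (label v ≤_) (d ++ label v ∷ [])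
      atLeast-v = Allₚ.++⁺ (All.map <⇒≤ above-v) (≤-refl All.∷ All.[])

    admissible⇒avoids : ∀ {x y z} → T (y <ᵇ z) → T (avoids p (x ∷ y ∷ z ∷ []))
    admissible⇒avoids {x} {y} {z} y<z = all-allFin⁺ _ λ v →
      let (t , d , path , desc , _) = chainUp-descending n v
      in ¬T⇒T-not (subst (λ w → ¬ T (containsPattern (x ∷ y ∷ z ∷ []) w)) (sym path) (descending-avoids y<z t desc))

  ¬admissible⇒violation : ¬ T (admissible p) →
    ∃ λ v → ∃ λ u → ∃ λ w → lookup p v ≡ just u × lookup p u ≡ just w × toℕ u ≤ toℕ v
  ¬admissible⇒violation ¬adm
    with Any.satisfied (¬All⇒Any¬ (T? ∘ admissibleAt p) (allFin n) (¬adm ∘ all⁻ (admissibleAt p)))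
  ... | v , bad with lookup p v in pv
  ...   | nothing = contradiction tt bad
  ...   | just u with lookup p u in pu
  ...     | nothing = contradiction tt bad
  ...     | just w  = v , u , w , pv , pu , ≮⇒≥ (bad ∘ <⇒<ᵇ)

  chainUp-suffix : ∀ {v u w} f → 2 ≤ f → lookup p v ≡ just u → lookup p u ≡ just w →
    ∃ λ pre → reverse (map label (chainUp p f v)) ≡ pre ++ label w ∷ label u ∷ label v ∷ []
  chainUp-suffix (suc zero) (s≤s ()) _ _
  chainUp-suffix {v} {u} {w} (suc (suc f)) _ pv pu with chainUp-head f w
  ... | rest , chain-w = reverse (map label rest) , (begin
    reverse (map label (chainUp p (suc (suc f)) v))
      ≡⟨ cong (reverse ∘ map label)
              (trans (chainUp-step (suc f) pv) (cong (v ∷_) (trans (chainUp-step f pu) (cong (u ∷_) chain-w)))) ⟩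
    reverse ((label v ∷ label u ∷ label w ∷ []) ++ map label rest)
      ≡⟨ reverse-++ (label v ∷ label u ∷ label w ∷ []) (map label rest) ⟩
    reverse (map label rest) ++ label w ∷ label u ∷ label v ∷ [] ∎)

  avoids⇒ : ∀ {σ} → T (avoids p σ) → ∀ v → ¬ T (containsPattern σ (rootPathLabels p v))
  avoids⇒ avoidsσ v = T-not⇒¬T (all-allFin⁻ _ avoidsσ v)

  violation⇒¬avoidsAll : T (isForest p) → ∀ {v u w} → lookup p v ≡ just u → lookup p u ≡ just w →
    toℕ u ≤ toℕ v → ¬ T (avoidsAll p forbidden)
  violation⇒¬avoidsAll forest {v} {u} {w} pv pu u≤v avoidsAll =
    avoids⇒ {Any.lookup occurring} (proj₁ found) v (contains {Any.lookup occurring} (proj₂ found))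
    where
    acyclic : ∀ {x y} → lookup p x ≡ just y → lookup p y ≡ just x → ⊥
    acyclic {x} px py = twoCycle-unreachable px py n (all-allFin⁻ (reachesRoot p n) forest x)
    u<v : toℕ u < toℕ v
    u<v = ≤∧≢⇒< u≤v λ u≡v →
      let pv′ = subst (λ z → lookup p v ≡ just z) (toℕ-injective u≡v) pv in acyclic pv′ pv′
    2≤n : 2 ≤ n
    2≤n = ≤-trans (s<s (≤-<-trans z≤n u<v)) (toℕ<n v)
    w≢u : label w ≢ label u
    w≢u w≡u = let pu′ = subst (λ z → lookup p u ≡ just z) (label-injective w≡u) pu in acyclic pu′ pu′
    w≢v : label w ≢ label v
    w≢v w≡v = acyclic pv (subst (λ z → lookup p u ≡ just z) (label-injective w≡v) pu)
    occurring : Any (λ σ → T (sameRelOrder σ (label w ∷ label u ∷ label v ∷ []))) forbidden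
    occurring = forbidden-triple (s<s u<v) w≢u w≢v
    found : T (avoids p (Any.lookup occurring)) × T (sameRelOrder (Any.lookup occurring) (label w ∷ label u ∷ label v ∷ []))
    found = All.lookupAny (all⁺ (avoids p) forbidden avoidsAll) occurring
    contains : ∀ {σ} → T (sameRelOrder σ (label w ∷ label u ∷ label v ∷ [])) →
      T (containsPattern σ (rootPathLabels p v))
    contains {σ} same with chainUp-suffix n 2≤n pv pu
    ... | pre , path = subst (T ∘ containsPattern σ) (sym path) (containsPattern-suffix σ pre _ same)

forest∧avoids≡admissible : ∀ {n} (p : ParentMap n) → (isForest p ∧ avoidsAll p forbidden) ≡ admissible p
forest∧avoids≡admissible p = T-ext forest∧avoids⇒admissible admissible⇒forest∧avoids
  where
  forest∧avoids⇒admissible : T (isForest p ∧ avoidsAll p forbidden) → T (admissible p)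
  forest∧avoids⇒admissible forest∧avoids = decidable-stable (T? _) λ ¬adm →
    let (forest , avoidsAll) = Equivalence.to T-∧ forest∧avoids
        (_ , _ , _ , pv , pu , u≤v) = ¬admissible⇒violation p ¬adm
    in violation⇒¬avoidsAll p forest pv pu u≤v avoidsAll
  admissible⇒forest∧avoids : T (admissible p) → T (isForest p ∧ avoidsAll p forbidden)
  admissible⇒forest∧avoids adm = Equivalence.from T-∧ (admissible⇒forest p adm , all⁻ (avoids p) {forbidden}
    (admissible⇒avoids p adm {3} {1} {2} tt All.∷ admissible⇒avoids p adm {2} {1} {3} tt All.∷
     admissible⇒avoids p adm {1} {2} {3} tt All.∷ All.[]))

theorem5p2 : (n : ℕ) → 1 ≤ n →
    f n ((3 ∷ 1 ∷ 2 ∷ []) ∷ (2 ∷ 1 ∷ 3 ∷ []) ∷ (1 ∷ 2 ∷ 3 ∷ []) ∷ []) ≡ bellStirlingSum n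
theorem5p2 (suc m) _ = begin
  f (suc m) forbidden
    ≡⟨ length-filterᵇ≡count _ (allParentMaps (suc m)) ⟩
  count (λ p → isForest p ∧ avoidsAll p forbidden) (allParentMaps (suc m))
    ≡⟨ count-cong (allParentMaps (suc m)) forest∧avoids≡admissible ⟩
  count admissible (allParentMaps (suc m))
    ≡⟨ count-admissible (suc m) ⟩
  markedCount (suc m) 0
    ≡⟨ markedCount≡stirling1Sum (suc m) 0 ⟩
  stirling1Sum (suc m) (rBell 0)
    ≡⟨ sym (bellStirlingSum≡stirling1Sum-bell m) ⟩
  bellStirlingSum (suc m) ∎
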